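{- Let $p_k$ be a prime and $p_{k+1}$ the next prime. Let $s$ be a constellation in $\mathcal{G}(p_k^\#)$ of length $J < p_{k+1}-2$ and span $|s| < 2p_{k+1}$. Then $$n_{s,J}(p_{k+1}^\#) \ge n_{s,J}(p_k^\#) \quad\text{and}\quad w_{s,J}(p_{k+1}^\#) \ge w_{s,J}(p_k^\#).$$
   Context: For a prime $p$, $p^\#$ is the product of all primes $\le p$. The $p$-rough numbers are the integers coprime to $p^\#$. The cycle of gaps $\mathcal{G}(p^\#)$ is the cyclic sequence of $\phi(p^\#)$ differences between consecutive $p$-rough numbers over one period, starting from $1$; it has total span $p^\#$. A constellation $s=s_1 s_2\cdots s_J$ is a finite sequence of consecutive gaps; its length is $J$ and its span is $|s|=s_1+\cdots+s_J$. A driving term for $s$ of length $j\ge J$ is a sequence of $j$ consecutive gaps of the cycle that can be partitioned into $J$ consecutive blocks whose sums are $s_1,\dots,s_J$ in order. $n_{s,j}(p^\#)$ denotes the number of driving terms for $s$ of length $j$ in the cycle $\mathcal{G}(p^\#)$ (so $n_{s,J}(p^\#)$ is the number of occurrences of $s$ itself). The relative population is $w_{s,J}(p_k^\#) = n_{s,J}(p_k^\#)\big/\prod_{J+1<q\le p_k,\ q \text{ prime}} (q-J-1)$. -}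

module Defs where

open import Data.Bool using (Bool; true; false; if_then_else_)
open import Data.Nat using (ℕ; zero; suc; _+_; _*_; _∸_; _<_; _≤_; _<?_; NonZero)
open import Data.Nat.Properties using (_≟_; m*n≢0)
open import Data.Nat.Primality using (Prime; prime?)
open import Data.Nat.Coprimality using (Coprime; coprime?)
open import Data.List using (List; []; _∷_; _++_; [_]; length; filter; map; upTo; drop)
open import Data.List.Properties using (≡-dec)
open import Relation.Nullary using (yes; no; does; ¬_)
open import Data.Product using (_×_; _,_)
open import Data.Integer using (+_)
open import Data.Rational using (ℚ; _/_)
open import Relation.Nullary.Decidable using (_×-dec_)

primorial : ℕ → ℕ
primorial zero    = 1
primorial (suc m) = (if does (prime? (suc m)) then suc m else 1) * primorial m

roughs : ℕ → List ℕ
roughs p = filter (λ m → coprime? m (primorial p)) (map suc (upTo (primorial p)))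

diffs : List ℕ → List ℕ
diffs (x ∷ y ∷ rest) = (y ∸ x) ∷ diffs (y ∷ rest)
diffs _              = []

-- the cycle of gaps G(p#), starting from 1: gaps between consecutive
-- p-rough numbers in [1, p# + 1]  (p# + 1 is the next rough number after
-- the last one in the period), a list of length φ(p#) read cyclically
gapCycle : ℕ → List ℕ
gapCycle p = diffs (roughs p ++ [ suc (primorial p) ])

-- take j consecutive entries of the cycle G starting at the list xs
-- (a suffix of G), wrapping around to the start of G as often as needed
cycTake : List ℕ → ℕ → List ℕ → List ℕ
cycTake G zero    _        = []
cycTake G (suc j) (x ∷ xs) = x ∷ cycTake G j xs
cycTake [] (suc j) []      = []
cycTake (y ∷ ys) (suc j) [] = y ∷ cycTake (y ∷ ys) j ys

window : List ℕ → ℕ → ℕ → List ℕ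
window G j i = cycTake G j (drop i G)

nsJ : List ℕ → ℕ → ℕ
nsJ s p = length (filter (λ i → ≡-dec _≟_ (window G (length s) i) s) (upTo (length G)))
  where G = gapCycle p

-- ∏_{J+1 < q ≤ p, q prime} (q - J - 1).  For q > J + 1 the factor
-- q - J - 1 is written as suc (q ∸ (J + 2)), which is the same number;
-- this makes nonzeroness of the product evident.
relFactor : ℕ → ℕ → ℕ
relFactor J q = if does (prime? q ×-dec (suc J <? q)) then suc (q ∸ suc (suc J)) else 1

relDen : ℕ → ℕ → ℕ
relDen J zero    = 1
relDen J (suc m) = relFactor J (suc m) * relDen J m

relFactor-nonZero : ∀ J q → NonZero (relFactor J q)
relFactor-nonZero J q with does (prime? q ×-dec (suc J <? q))
... | true  = _
... | false = _

instance
  relDen-nonZero : ∀ {J p} → NonZero (relDen J p)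
  relDen-nonZero {J} {zero}  = _
  relDen-nonZero {J} {suc m} =
    m*n≢0 (relFactor J (suc m)) (relDen J m) {{relFactor-nonZero J (suc m)}} {{relDen-nonZero {J} {m}}}

wsJ : List ℕ → ℕ → ℚ
wsJ s p = _/_ (+ nsJ s p) (relDen (length s) p) {{relDen-nonZero {length s} {p}}}

NextPrime : ℕ → ℕ → Set
NextPrime p q = Prime p × Prime q × p < q × (∀ m → p < m → m < q → ¬ Prime m)

-- Let q be the prime after p and J the length of s. Each a ∈ [1, p#] at which s occurs in G(p#)
-- has q lifts a + k·p# (k < q) in [1, q#]; they are p-rough with the same gaps s after them in
-- G(p#), and a lift is an occurrence of s in G(q#) unless q divides one of its J + 1 points
-- a + k·p# + (s₁ + ⋯ + sᵢ). As q ∤ p#, each point is divisible by q for at most one k, so at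
-- least q − J − 1 lifts survive. Hence n_{s,J}(q#) ≥ (q − J − 1)·n_{s,J}(p#), while the
-- denominator of w_{s,J} grows by exactly the factor q − J − 1.
module Submission where

open import Defs
open import Data.Nat using (ℕ; _+_; _*_; _<_; _≤_; _∸_)
open import Data.List using (List; length)
open import Data.Nat.ListAction using (sum)
open import Data.Rational using (ℚ)
open import Data.Product using (_×_)
import Data.Rational as Q

open import Data.Bool using (true; false; if_then_else_)
open import Data.Empty using (⊥-elim)
import Data.Integer as ℤ
import Data.Integer.Properties as ℤ
open import Data.List using ([]; _∷_; _++_; [_]; filter; map; upTo; drop; applyUpTo)
open import Data.List.Properties using (≡-dec; ∷-injective; filter-accept; filter-reject; map-applyUpTo)
open import Data.Nat using (zero; suc; NonZero; >-nonZero; ≢-nonZero⁻¹; nonTrivial⇒n>1; z≤n; s≤s; s≤s⁻¹; z<s; _<?_)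
open import Data.Nat.Coprimality using (Coprime; coprime?; coprime-+; coprime-divisor)
open import Data.Nat.Divisibility using (_∣_; _∣?_; ∣⇒≤; ∣-trans; ∣n⇒∣m*n; ∣1⇒≡1; ∣m+n∣m⇒∣n; ∣m∣n⇒∣m+n)
open import Data.Nat.Primality using (Prime; prime?; euclidsLemma; prime⇒nonTrivial; prime⇒irreducible)
open import Data.Nat.Properties
open import Algebra.Properties.CommutativeSemigroup +-commutativeSemigroup using (interchange)
open import Data.Product using (_,_; proj₁; proj₂; ∃₂)
open import Data.Rational.Properties using (toℚᵘ-cancel-≤; toℚᵘ-fromℚᵘ)
import Data.Rational.Unnormalised as ℚᵘ
import Data.Rational.Unnormalised.Properties as ℚᵘ
open import Data.Sum using (inj₁; inj₂)
open import Data.Unit using (⊤; tt)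
open import Function using (_∘_)
open import Function.Bundles using (_⇔_; mk⇔; Equivalence)
open import Function.Properties.Equivalence using () renaming (refl to ⇔-refl; sym to ⇔-sym; trans to ⇔-trans)
open import Relation.Binary.Definitions using (tri<; tri≈; tri>)
open import Relation.Binary.PropositionalEquality hiding ([_]; J)
open import Relation.Nullary using (Dec; yes; no; ¬_; does)
open import Relation.Nullary.Decidable using (_×-dec_; _→-dec_; ¬?; dec-true; dec-false)

open Equivalence using (to; from)

𝟙 : ∀ {a} {A : Set a} → Dec A → ℕ
𝟙 (yes _) = 1
𝟙 (no _)  = 0

𝟙-cong : ∀ {a b} {A : Set a} {B : Set b} → A ⇔ B → (A? : Dec A) (B? : Dec B) → 𝟙 A? ≡ 𝟙 B?
𝟙-cong A⇔B (yes _) (yes _) = refl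
𝟙-cong A⇔B (yes a) (no ¬b) = ⊥-elim (¬b (to A⇔B a))
𝟙-cong A⇔B (no ¬a) (yes b) = ⊥-elim (¬a (from A⇔B b))
𝟙-cong A⇔B (no _)  (no _)  = refl

𝟙≡0⇒¬ : ∀ {a} {A : Set a} (A? : Dec A) → 𝟙 A? ≡ 0 → ¬ A
𝟙≡0⇒¬ (no ¬a) _ = ¬a

∑< : ℕ → (ℕ → ℕ) → ℕ
∑< zero    f = 0
∑< (suc n) f = f 0 + ∑< n (f ∘ suc)

syntax ∑< n (λ i → e) = ∑[ i < n ] e

∑-cong : ∀ n {f g : ℕ → ℕ} → (∀ i → f i ≡ g i) → ∑< n f ≡ ∑< n g
∑-cong zero    f≗g = refl
∑-cong (suc n) f≗g = cong₂ _+_ (f≗g 0) (∑-cong n (f≗g ∘ suc))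

∑-mono-≤ : ∀ n {f g : ℕ → ℕ} → (∀ i → f i ≤ g i) → ∑< n f ≤ ∑< n g
∑-mono-≤ zero    f≤g = z≤n
∑-mono-≤ (suc n) f≤g = +-mono-≤ (f≤g 0) (∑-mono-≤ n (f≤g ∘ suc))

∑-const : ∀ n c → ∑[ i < n ] c ≡ n * c
∑-const zero    c = refl
∑-const (suc n) c = cong (c +_) (∑-const n c)

∑-distrib-+ : ∀ n (f g : ℕ → ℕ) → ∑[ i < n ] (f i + g i) ≡ ∑< n f + ∑< n g
∑-distrib-+ zero    f g = refl
∑-distrib-+ (suc n) f g = trans (cong (f 0 + g 0 +_) (∑-distrib-+ n (f ∘ suc) (g ∘ suc)))
                                (interchange (f 0) (g 0) (∑< n (f ∘ suc)) (∑< n (g ∘ suc)))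

*-distribˡ-∑ : ∀ c n (f : ℕ → ℕ) → c * ∑< n f ≡ ∑[ i < n ] (c * f i)
*-distribˡ-∑ c zero    f = *-zeroʳ c
*-distribˡ-∑ c (suc n) f = trans (*-distribˡ-+ c (f 0) _) (cong (c * f 0 +_) (*-distribˡ-∑ c n (f ∘ suc)))

∑-+ : ∀ m n (f : ℕ → ℕ) → ∑< (m + n) f ≡ ∑< m f + ∑[ i < n ] f (m + i)
∑-+ zero    n f = refl
∑-+ (suc m) n f = trans (cong (f 0 +_) (∑-+ m n (f ∘ suc))) (sym (+-assoc (f 0) _ _))

∑-* : ∀ m n (f : ℕ → ℕ) → ∑< (m * n) f ≡ ∑[ k < m ] ∑[ i < n ] f (k * n + i)
∑-* zero    n f = refl
∑-* (suc m) n f = trans (∑-+ n (m * n) f) (cong (∑< n f +_) (begin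
  ∑[ j < m * n ] f (n + j)                     ≡⟨ ∑-* m n (λ j → f (n + j)) ⟩
  ∑[ k < m ] ∑[ i < n ] f (n + (k * n + i))    ≡⟨ ∑-cong m (λ k → ∑-cong n (λ i → cong f (sym (+-assoc n (k * n) i)))) ⟩
  ∑[ k < m ] ∑[ i < n ] f (n + k * n + i)      ∎))
  where open ≡-Reasoning

∑-comm : ∀ m n (f : ℕ → ℕ → ℕ) → ∑[ i < m ] ∑[ j < n ] f i j ≡ ∑[ j < n ] ∑[ i < m ] f i j
∑-comm zero    n f = sym (trans (∑-const n 0) (*-zeroʳ n))
∑-comm (suc m) n f = trans (cong (∑< n (f 0) +_) (∑-comm m n (f ∘ suc)))
                           (sym (∑-distrib-+ n (f 0) (λ j → ∑[ i < m ] f (suc i) j)))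

∑-𝟙-≤1 : ∀ n {D : ℕ → Set} (D? : ∀ i → Dec (D i)) →
         (∀ {i j} → i < n → j < n → D i → D j → i ≡ j) → ∑[ i < n ] 𝟙 (D? i) ≤ 1
∑-𝟙-≤1 zero    D? unique = z≤n
∑-𝟙-≤1 (suc n) D? unique with D? 0
... | no _   = ∑-𝟙-≤1 n (D? ∘ suc) (λ i<n j<n Di Dj → suc-injective (unique (s≤s i<n) (s≤s j<n) Di Dj))
... | yes D0 = s≤s (≤-reflexive (∑-zero n others-fail))
  where
  ∑-zero : ∀ n {f : ℕ → ℕ} → (∀ {i} → i < n → f i ≡ 0) → ∑< n f ≡ 0
  ∑-zero zero    f≡0 = refl
  ∑-zero (suc n) f≡0 = cong₂ _+_ (f≡0 z<s) (∑-zero n (f≡0 ∘ s≤s))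
  others-fail : ∀ {i} → i < n → 𝟙 (D? (suc i)) ≡ 0
  others-fail {i} i<n with D? (suc i)
  ... | yes Di = ⊥-elim (1+n≢0 (unique (s≤s i<n) z<s Di D0))
  ... | no _   = refl

length-filter-∷ : ∀ {P : ℕ → Set} (P? : ∀ x → Dec (P x)) x xs →
                  length (filter P? (x ∷ xs)) ≡ 𝟙 (P? x) + length (filter P? xs)
length-filter-∷ P? x xs with P? x
... | yes _ = refl
... | no _  = refl

length-filter-applyUpTo : ∀ {P : ℕ → Set} (P? : ∀ x → Dec (P x)) f n →
                          length (filter P? (applyUpTo f n)) ≡ ∑[ i < n ] 𝟙 (P? (f i))
length-filter-applyUpTo P? f zero    = refl
length-filter-applyUpTo P? f (suc n) =
  trans (length-filter-∷ P? (f 0) _) (cong (𝟙 (P? (f 0)) +_) (length-filter-applyUpTo P? (f ∘ suc) n))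

length-filter-filter : ∀ {P Q : ℕ → Set} (P? : ∀ x → Dec (P x)) (Q? : ∀ x → Dec (Q x)) xs →
                       length (filter Q? (filter P? xs)) ≡ length (filter (λ x → P? x ×-dec Q? x) xs)
length-filter-filter P? Q? []       = refl
length-filter-filter P? Q? (x ∷ xs) with P? x
... | no _  = length-filter-filter P? Q? xs
... | yes _ with Q? x
...   | yes _ = cong suc (length-filter-filter P? Q? xs)
...   | no _  = length-filter-filter P? Q? xs

length-diffs-∷ʳ : ∀ xs y → length (diffs (xs ++ [ y ])) ≡ length xs
length-diffs-∷ʳ []            y = refl
length-diffs-∷ʳ (x ∷ [])      y = refl
length-diffs-∷ʳ (x ∷ x′ ∷ xs) y = cong suc (length-diffs-∷ʳ (x′ ∷ xs) y)

drop-diffs : ∀ i xs → drop i (diffs xs) ≡ diffs (drop i xs)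
drop-diffs zero          xs           = refl
drop-diffs (suc i)       []           = refl
drop-diffs (suc zero)    (x ∷ [])     = refl
drop-diffs (suc (suc i)) (x ∷ [])     = refl
drop-diffs (suc i)       (x ∷ y ∷ xs) = drop-diffs i (y ∷ xs)

/-mono-≤ : ∀ a b c d .{{_ : NonZero b}} .{{_ : NonZero d}} →
           a * d ≤ c * b → ℤ.+ a Q./ b Q.≤ ℤ.+ c Q./ d
/-mono-≤ a (suc b) c (suc d) ad≤cb = toℚᵘ-cancel-≤
  (ℚᵘ.≤-respʳ-≃ (ℚᵘ.≃-sym (toℚᵘ-fromℚᵘ y)) (ℚᵘ.≤-respˡ-≃ (ℚᵘ.≃-sym (toℚᵘ-fromℚᵘ x))
    (ℚᵘ.*≤* (subst₂ ℤ._≤_ (ℤ.pos-* a (suc d)) (ℤ.pos-* c (suc b)) (ℤ.+≤+ ad≤cb)))))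
  where
  x = ℚᵘ.mkℚᵘ (ℤ.+ a) b
  y = ℚᵘ.mkℚᵘ (ℤ.+ c) d

module _ (F : ℕ → ℕ) (F-nonPrime : ∀ m → ¬ Prime (suc m) → F (suc m) ≡ F m) where

  constant-between-primes : ∀ {p m} → p ≤ m → (∀ {k} → p < k → k ≤ m → ¬ Prime k) → F m ≡ F p
  constant-between-primes {m = zero}  z≤n no-prime = refl
  constant-between-primes {m = suc m} p≤1+m no-prime with m≤n⇒m<n∨m≡n p≤1+m
  ... | inj₂ refl  = refl
  ... | inj₁ p<1+m = trans (F-nonPrime m (no-prime p<1+m ≤-refl))
                           (constant-between-primes (s≤s⁻¹ p<1+m) (λ p<k k≤m → no-prime p<k (m≤n⇒m≤1+n k≤m)))

  constant-below-nextPrime : ∀ {p m} → NextPrime p (suc m) → F m ≡ F p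
  constant-below-nextPrime (_ , _ , p<1+m , no-prime) =
    constant-between-primes (s≤s⁻¹ p<1+m) (λ p<k k≤m → no-prime _ p<k (s≤s k≤m))

primorial-nonPrime : ∀ m → ¬ Prime (suc m) → primorial (suc m) ≡ primorial m
primorial-nonPrime m ¬prime =
  trans (cong (λ b → (if b then suc m else 1) * primorial m) (dec-false (prime? (suc m)) ¬prime))
        (+-identityʳ (primorial m))

primorial-nextPrime : ∀ {p q} → NextPrime p q → primorial q ≡ q * primorial p
primorial-nextPrime {p} {suc m} np@(_ , prime-q , _) = begin
  (if does (prime? (suc m)) then suc m else 1) * primorial m ≡⟨ cong (λ b → (if b then suc m else 1) * primorial m)
                                                                     (dec-true (prime? (suc m)) prime-q) ⟩
  suc m * primorial m                                        ≡⟨ cong (suc m *_) (constant-below-nextPrime primorial primorial-nonPrime np) ⟩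
  suc m * primorial p                                        ∎
  where open ≡-Reasoning

primorial-nonZero : ∀ m → NonZero (primorial m)
primorial-nonZero zero    = _
primorial-nonZero (suc m) with does (prime? (suc m))
... | true  = m*n≢0 (suc m) (primorial m) {{_}} {{primorial-nonZero m}}
... | false = m*n≢0 1 (primorial m) {{_}} {{primorial-nonZero m}}

prime∤primorial : ∀ {q} → Prime q → ∀ {m} → m < q → ¬ q ∣ primorial m
prime∤primorial {q} prime-q {zero}  _     q∣1 = <-irrefl (sym (∣1⇒≡1 q∣1)) (nonTrivial⇒n>1 q {{prime⇒nonTrivial prime-q}})
prime∤primorial {q} prime-q {suc m} 1+m<q q∣F with euclidsLemma _ (primorial m) prime-q q∣F
... | inj₂ q∣F′     = prime∤primorial prime-q (<-trans (n<1+n m) 1+m<q) q∣F′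
... | inj₁ q∣factor = factor-small (does (prime? (suc m))) q∣factor
  where
  factor-small : ∀ b → ¬ q ∣ (if b then suc m else 1)
  factor-small true  q∣1+m = <⇒≱ 1+m<q (∣⇒≤ {{>-nonZero z<s}} q∣1+m)
  factor-small false q∣1   = <⇒≱ (≤-trans (s≤s (s≤s z≤n)) 1+m<q) (∣⇒≤ {{>-nonZero z<s}} q∣1)

relDen-nonPrime : ∀ J m → ¬ Prime (suc m) → relDen J (suc m) ≡ relDen J m
relDen-nonPrime J m ¬prime =
  trans (cong (λ b → (if b then suc (suc m ∸ suc (suc J)) else 1) * relDen J m)
              (dec-false (prime? (suc m) ×-dec (suc J <? suc m)) (¬prime ∘ proj₁)))
        (+-identityʳ (relDen J m))

relDen-nextPrime : ∀ J {p q} → NextPrime p q → suc J < q → relDen J q ≡ (q ∸ suc J) * relDen J p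
relDen-nextPrime J {p} {suc m} np@(_ , prime-q , _) 1+J<q = begin
  relFactor J (suc m) * relDen J m ≡⟨ cong (λ b → (if b then suc (suc m ∸ suc (suc J)) else 1) * relDen J m)
                                           (dec-true (prime? (suc m) ×-dec (suc J <? suc m)) (prime-q , 1+J<q)) ⟩
  suc (m ∸ suc J) * relDen J m     ≡⟨ cong (_* relDen J m) (sym (+-∸-assoc 1 (s≤s⁻¹ 1+J<q))) ⟩
  (m ∸ J) * relDen J m             ≡⟨ cong ((m ∸ J) *_) (constant-below-nextPrime (relDen J) (relDen-nonPrime J) np) ⟩
  (m ∸ J) * relDen J p             ∎
  where open ≡-Reasoning

module GapCycle (M : ℕ) .{{_ : NonZero M}} where

  Rough : ℕ → Set
  Rough n = Coprime n M

  rough? : ∀ n → Dec (Rough n)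
  rough? n = coprime? n M

  IsGap : ℕ → ℕ → Set
  IsGap x g = 0 < g × Rough (x + g) × (∀ {d} → d < g → 0 < d → ¬ Rough (x + d))

  isGap? : ∀ x g → Dec (IsGap x g)
  isGap? x g = 0 <? g ×-dec rough? (x + g) ×-dec allUpTo? (λ d → 0 <? d →-dec ¬? (rough? (x + d))) g

  Chain : ℕ → List ℕ → Set
  Chain x []      = ⊤
  Chain x (g ∷ s) = IsGap x g × Chain (x + g) s

  chain? : ∀ x s → Dec (Chain x s)
  chain? x []      = yes tt
  chain? x (g ∷ s) = isGap? x g ×-dec chain? (x + g) s

  OccursAt : ℕ → List ℕ → Set
  OccursAt a s = Rough a × Chain a s

  occursAt? : ∀ a s → Dec (OccursAt a s)
  occursAt? a s = rough? a ×-dec chain? a s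

  isGap-unique : ∀ {x g h} → IsGap x g → IsGap x h → g ≡ h
  isGap-unique {g = g} {h} (g>0 , rough-g , below-g) (h>0 , rough-h , below-h) with <-cmp g h
  ... | tri< g<h _ _ = ⊥-elim (below-h g<h g>0 rough-g)
  ... | tri≈ _ g≡h _ = g≡h
  ... | tri> _ _ h<g = ⊥-elim (below-g h<g h>0 rough-h)

  rough-1 : Rough 1
  rough-1 (d∣1 , _) = ∣1⇒≡1 d∣1

  rough-shift : ∀ n → Rough (M + n) ⇔ Rough n
  rough-shift n = mk⇔ (λ rough-M+n {d} (d∣n , d∣M) → rough-M+n (∣m∣n⇒∣m+n d∣M d∣n , d∣M))
                      (λ rough-n {d} → coprime-+ rough-n)

  isGap-shift : ∀ x g → IsGap (M + x) g ⇔ IsGap x g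
  isGap-shift x g = mk⇔
    (λ (g>0 , rough-g , below-g) → g>0 , to (shift g) rough-g , λ d<g d>0 → below-g d<g d>0 ∘ from (shift _))
    (λ (g>0 , rough-g , below-g) → g>0 , from (shift g) rough-g , λ d<g d>0 → below-g d<g d>0 ∘ to (shift _))
    where
    shift : ∀ d → Rough (M + x + d) ⇔ Rough (x + d)
    shift d = subst (λ n → Rough n ⇔ Rough (x + d)) (sym (+-assoc M x d)) (rough-shift (x + d))

  chain-shift : ∀ x s → Chain (M + x) s ⇔ Chain x s
  chain-shift x []      = mk⇔ (λ _ → tt) (λ _ → tt)
  chain-shift x (g ∷ s) = mk⇔
    (λ (gap , chain) → to (isGap-shift x g) gap , to (chain-shift (x + g) s) (subst (λ y → Chain y s) (+-assoc M x g) chain))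
    (λ (gap , chain) → from (isGap-shift x g) gap , subst (λ y → Chain y s) (sym (+-assoc M x g)) (from (chain-shift (x + g) s) chain))

  occursAt-+* : ∀ k {x} s → OccursAt x s → OccursAt (k * M + x) s
  occursAt-+* zero    s occ = occ
  occursAt-+* (suc k) {x} s occ = subst (λ y → OccursAt y s) (sym (+-assoc M (k * M) x))
    (from (rough-shift (k * M + x)) (proj₁ occ′) , from (chain-shift (k * M + x) s) (proj₂ occ′))
    where
    occ′ = occursAt-+* k s occ

  -- L lists the M-rough numbers after x in increasing order, closed off by M + 1, the first
  -- rough number of the next period (the sentinel that gapCycle appends to roughs).
  RoughsAfter : ℕ → List ℕ → Set
  RoughsAfter x []      = x ≡ suc M
  RoughsAfter x (y ∷ L) = x < y × IsGap x (y ∸ x) × RoughsAfter y L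

  roughsAfter-0 : ∀ {L} → RoughsAfter 0 L → ∃₂ λ y rest → L ≡ 1 ∷ y ∷ rest × RoughsAfter 1 (y ∷ rest)
  roughsAfter-0 {1 ∷ []}          (_ , _ , 1≡1+M)            = ⊥-elim (≢-nonZero⁻¹ M (sym (suc-injective 1≡1+M)))
  roughsAfter-0 {1 ∷ y ∷ rest}    (_ , _ , after-1)          = y , rest , refl , after-1
  roughsAfter-0 {suc (suc k) ∷ _} (_ , (_ , _ , below) , _) = ⊥-elim (below (s≤s (s≤s z≤n)) z<s rough-1)

  module Windows (L : List ℕ) (after-0 : RoughsAfter 0 L) where

    G : List ℕ
    G = diffs L

    cycTake-wrap : ∀ {y rest} → L ≡ 1 ∷ y ∷ rest → ∀ n →
                   cycTake G (suc n) [] ≡ cycTake G (suc n) (diffs (1 ∷ y ∷ rest))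
    cycTake-wrap L≡ n =
      trans (subst (λ L′ → cycTake (diffs L′) (suc n) [] ≡ cycTake (diffs L′) (suc n) (diffs L′)) (sym L≡) refl)
            (cong (cycTake G (suc n) ∘ diffs) L≡)

    window-chain   : ∀ s {x K} → RoughsAfter x K →
                     (cycTake G (length s) (diffs (x ∷ K)) ≡ s) ⇔ Chain x s
    window-chain-∷ : ∀ g s {x y K} → RoughsAfter x (y ∷ K) →
                     (cycTake G (suc (length s)) (diffs (x ∷ y ∷ K)) ≡ g ∷ s) ⇔ Chain x (g ∷ s)

    window-chain []      _                     = mk⇔ (λ _ → tt) (λ _ → refl)
    window-chain (g ∷ s) {K = y ∷ K} after-x   = window-chain-∷ g s after-x
    -- A window running off the end of the cycle resumes at 1, which is M + 1 shifted back by M.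
    window-chain (g ∷ s) {K = []}    refl      with roughsAfter-0 after-0
    ... | y , rest , L≡ , after-1 =
      subst (λ t → (t ≡ g ∷ s) ⇔ Chain (suc M) (g ∷ s)) (sym (cycTake-wrap L≡ (length s)))
        (⇔-trans (window-chain-∷ g s after-1)
        (⇔-trans (⇔-sym (chain-shift 1 (g ∷ s)))
                 (subst (λ x → Chain (M + 1) (g ∷ s) ⇔ Chain x (g ∷ s)) (+-comm M 1) ⇔-refl)))

    window-chain-∷ g s {x} {y} (x<y , gap , after-y) = mk⇔
      (λ e → let y∸x≡g , e′ = ∷-injective e in
             subst (IsGap x) y∸x≡g gap , subst (λ z → Chain z s) (sym (x+g≡y y∸x≡g)) (to (window-chain s after-y) e′))
      (λ (gap′ , chain) → let y∸x≡g = isGap-unique gap gap′ in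
             cong₂ _∷_ y∸x≡g (from (window-chain s after-y) (subst (λ z → Chain z s) (x+g≡y y∸x≡g) chain)))
      where
      x+g≡y : ∀ {g} → y ∸ x ≡ g → x + g ≡ y
      x+g≡y refl = m+[n∸m]≡n (<⇒≤ x<y)

    count-windows : ∀ s {x} ys → RoughsAfter x (ys ++ [ suc M ]) →
      ∑[ i < length ys ] 𝟙 (≡-dec _≟_ (cycTake G (length s) (diffs (drop i (ys ++ [ suc M ])))) s)
        ≡ length (filter (λ y → chain? y s) ys)
    count-windows s []       _                  = refl
    count-windows s (y ∷ ys) (_ , _ , after-y) = sym (begin
      length (filter (λ y → chain? y s) (y ∷ ys))             ≡⟨ length-filter-∷ (λ y → chain? y s) y ys ⟩
      𝟙 (chain? y s) + length (filter (λ y → chain? y s) ys) ≡⟨ cong₂ _+_ (𝟙-cong (⇔-sym (window-chain s after-y)) _ _)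
                                                                          (sym (count-windows s ys after-y)) ⟩
      _                                                       ∎)
      where open ≡-Reasoning

  NoRoughBetween : ℕ → ℕ → Set
  NoRoughBetween x a = ∀ {d} → 0 < d → x + d < a → ¬ Rough (x + d)

  isGap-∸ : ∀ {x a} → x < a → Rough a → NoRoughBetween x a → IsGap x (a ∸ x)
  isGap-∸ {x} {a} x<a rough-a none =
      m<n⇒0<n∸m x<a
    , subst Rough (sym x+[a∸x]≡a) rough-a
    , λ d<a∸x d>0 → none d>0 (subst (x + _ <_) x+[a∸x]≡a (+-monoʳ-< x d<a∸x))
    where
    x+[a∸x]≡a : x + (a ∸ x) ≡ a
    x+[a∸x]≡a = m+[n∸m]≡n (<⇒≤ x<a)

  roughsAfter-filter : ∀ n {x} (f : ℕ → ℕ) → (∀ i → f (suc i) ≡ suc (f i)) → f n ≡ suc M →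
                       x < f 0 → NoRoughBetween x (f 0) → RoughsAfter x (filter rough? (applyUpTo f n) ++ [ suc M ])
  roughsAfter-filter zero {x} f _ end x<f0 none =
    subst (λ a → RoughsAfter x (a ∷ [])) end (x<f0 , isGap-∸ x<f0 (subst Rough (sym end) rough-1+M) none , end)
    where
    rough-1+M : Rough (suc M)
    rough-1+M = subst Rough (+-comm M 1) (from (rough-shift 1) rough-1)
  roughsAfter-filter (suc n) {x} f step end x<f0 none with rough? (f 0)
  ... | yes rough-f0 = subst (λ L → RoughsAfter x (L ++ [ suc M ])) (sym (filter-accept rough? rough-f0))
    (x<f0 , isGap-∸ x<f0 rough-f0 none ,
     roughsAfter-filter n (f ∘ suc) (step ∘ suc) end f0<f1 λ d>0 f0+d<f1 → ⊥-elim (<⇒≱ f0+d<f1 (f1≤f0+d d>0)))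
    where
    f0<f1 : f 0 < f 1
    f0<f1 = subst (f 0 <_) (sym (step 0)) ≤-refl
    f1≤f0+d : ∀ {d} → 0 < d → f 1 ≤ f 0 + d
    f1≤f0+d {d} d>0 = subst (_≤ f 0 + d) (trans (+-comm (f 0) 1) (sym (step 0))) (+-monoʳ-≤ (f 0) d>0)
  ... | no ¬rough-f0 = subst (λ L → RoughsAfter x (L ++ [ suc M ])) (sym (filter-reject rough? ¬rough-f0))
    (roughsAfter-filter n (f ∘ suc) (step ∘ suc) end (<-trans x<f0 (subst (f 0 <_) (sym (step 0)) ≤-refl)) none′)
    where
    none′ : NoRoughBetween x (f 1)
    none′ d>0 x+d<f1 with m≤n⇒m<n∨m≡n (s≤s⁻¹ (subst (_ <_) (step 0) x+d<f1))
    ... | inj₁ x+d<f0 = none d>0 x+d<f0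
    ... | inj₂ x+d≡f0 = ¬rough-f0 ∘ subst Rough x+d≡f0

  periodRoughs : List ℕ
  periodRoughs = filter rough? (map suc (upTo M))

  roughsAfter-periodRoughs : RoughsAfter 0 (periodRoughs ++ [ suc M ])
  roughsAfter-periodRoughs =
    subst (λ xs → RoughsAfter 0 (filter rough? xs ++ [ suc M ])) (sym (map-applyUpTo (λ i → i) suc M))
          (roughsAfter-filter M suc (λ _ → refl) refl z<s λ d>0 d<1 → ⊥-elim (<⇒≱ d<1 d>0))

  windows≡occurrences : ∀ s → let G = diffs (periodRoughs ++ [ suc M ]) in
    length (filter (λ i → ≡-dec _≟_ (window G (length s) i) s) (upTo (length G)))
      ≡ ∑[ a < M ] 𝟙 (occursAt? (suc a) s)
  windows≡occurrences s = begin
    length (filter (λ i → ≡-dec _≟_ (window G J i) s) (upTo (length G)))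
      ≡⟨ length-filter-applyUpTo _ (λ i → i) (length G) ⟩
    ∑[ i < length G ] 𝟙 (≡-dec _≟_ (cycTake G J (drop i G)) s)
      ≡⟨ cong (λ n → ∑[ i < n ] 𝟙 (≡-dec _≟_ (cycTake G J (drop i G)) s)) (length-diffs-∷ʳ periodRoughs (suc M)) ⟩
    ∑[ i < length periodRoughs ] 𝟙 (≡-dec _≟_ (cycTake G J (drop i G)) s)
      ≡⟨ ∑-cong (length periodRoughs) (λ i → cong (λ t → 𝟙 (≡-dec _≟_ (cycTake G J t) s)) (drop-diffs i L)) ⟩
    ∑[ i < length periodRoughs ] 𝟙 (≡-dec _≟_ (cycTake G J (diffs (drop i L))) s)
      ≡⟨ Windows.count-windows L roughsAfter-periodRoughs s periodRoughs roughsAfter-periodRoughs ⟩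
    length (filter (λ a → chain? a s) periodRoughs)
      ≡⟨ length-filter-filter rough? (λ a → chain? a s) (map suc (upTo M)) ⟩
    length (filter (λ a → occursAt? a s) (map suc (upTo M)))
      ≡⟨ cong (length ∘ filter (λ a → occursAt? a s)) (map-applyUpTo (λ i → i) suc M) ⟩
    length (filter (λ a → occursAt? a s) (applyUpTo suc M))
      ≡⟨ length-filter-applyUpTo (λ a → occursAt? a s) suc M ⟩
    ∑[ a < M ] 𝟙 (occursAt? (suc a) s) ∎
    where
    open ≡-Reasoning
    L = periodRoughs ++ [ suc M ]
    G = diffs L
    J = length s

module Lift (P q Q : ℕ) .{{_ : NonZero P}} .{{_ : NonZero Q}}
            (prime-q : Prime q) (q∤P : ¬ q ∣ P) (Q≡qP : Q ≡ q * P) where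

  module GP = GapCycle P
  module GQ = GapCycle Q

  roughQ⇒roughP : ∀ {n} → GQ.Rough n → GP.Rough n
  roughQ⇒roughP roughQ (d∣n , d∣P) = roughQ (d∣n , subst (_ ∣_) (sym Q≡qP) (∣n⇒∣m*n q d∣P))

  roughP⇒roughQ : ∀ {n} → GP.Rough n → ¬ q ∣ n → GQ.Rough n
  roughP⇒roughQ {n} roughP q∤n {d} (d∣n , d∣Q) =
    roughP (d∣n , coprime-divisor d⊥q (subst (d ∣_) Q≡qP d∣Q))
    where
    d⊥q : Coprime d q
    d⊥q (e∣d , e∣q) with prime⇒irreducible prime-q e∣q
    ... | inj₁ e≡1  = e≡1
    ... | inj₂ refl = ⊥-elim (q∤n (∣-trans e∣d d∣n))

  qDivisiblePoints : ℕ → List ℕ → ℕ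
  qDivisiblePoints b []      = 𝟙 (q ∣? b)
  qDivisiblePoints b (g ∷ s) = 𝟙 (q ∣? b) + qDivisiblePoints (b + g) s

  occursAt-lift : ∀ {b} s → GP.OccursAt b s → qDivisiblePoints b s ≡ 0 → GQ.OccursAt b s
  occursAt-lift {b} []      (roughP , tt) none = roughP⇒roughQ roughP (𝟙≡0⇒¬ (q ∣? b) none) , tt
  occursAt-lift {b} (g ∷ s) (roughP , (g>0 , rough-g , below) , chain) none =
    roughP⇒roughQ roughP (𝟙≡0⇒¬ (q ∣? b) (m+n≡0⇒m≡0 _ none)) ,
    (g>0 , proj₁ next , λ d<g d>0 → below d<g d>0 ∘ roughQ⇒roughP) , proj₂ next
    where
    next = occursAt-lift s (rough-g , chain) (m+n≡0⇒n≡0 _ none)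

  occursAt-or-divisible : ∀ {b} s → GP.OccursAt b s → 1 ≤ 𝟙 (GQ.occursAt? b s) + qDivisiblePoints b s
  occursAt-or-divisible {b} s occ with qDivisiblePoints b s in eq
  ... | suc n = ≤-trans (s≤s z≤n) (m≤n+m (suc n) _)
  ... | zero with GQ.occursAt? b s
  ...   | yes _   = s≤s z≤n
  ...   | no ¬occ = ⊥-elim (¬occ (occursAt-lift s occ eq))

  ∤-difference : ∀ x {i j} → i < j → j < q → q ∣ i * P + x → ¬ q ∣ j * P + x
  ∤-difference x {i} {j} i<j j<q q∣i q∣j
    with euclidsLemma (j ∸ i) P prime-q (∣m+n∣m⇒∣n (subst (q ∣_) split q∣j) q∣i)
    where
    open ≡-Reasoning
    split : j * P + x ≡ i * P + x + (j ∸ i) * P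
    split = begin
      j * P + x                 ≡⟨ cong (λ n → n * P + x) (sym (m∸n+n≡m (<⇒≤ i<j))) ⟩
      (j ∸ i + i) * P + x       ≡⟨ cong (_+ x) (*-distribʳ-+ P (j ∸ i) i) ⟩
      (j ∸ i) * P + i * P + x   ≡⟨ +-assoc ((j ∸ i) * P) (i * P) x ⟩
      (j ∸ i) * P + (i * P + x) ≡⟨ +-comm ((j ∸ i) * P) (i * P + x) ⟩
      i * P + x + (j ∸ i) * P   ∎
  ... | inj₂ q∣P   = q∤P q∣P
  ... | inj₁ q∣j∸i = <⇒≱ (≤-<-trans (m∸n≤m j i) j<q) (∣⇒≤ {{>-nonZero (m<n⇒0<n∸m i<j)}} q∣j∸i)

  divisor-unique : ∀ x {i j} → i < q → j < q → q ∣ i * P + x → q ∣ j * P + x → i ≡ j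
  divisor-unique x {i} {j} i<q j<q q∣i q∣j with <-cmp i j
  ... | tri< i<j _ _ = ⊥-elim (∤-difference x i<j j<q q∣i q∣j)
  ... | tri≈ _ i≡j _ = i≡j
  ... | tri> _ _ j<i = ⊥-elim (∤-difference x j<i i<q q∣j q∣i)

  divisible-once : ∀ x → ∑[ k < q ] 𝟙 (q ∣? (k * P + x)) ≤ 1
  divisible-once x = ∑-𝟙-≤1 q (λ k → q ∣? (k * P + x)) (divisor-unique x)

  qDivisiblePoints-bound : ∀ x s → ∑[ k < q ] qDivisiblePoints (k * P + x) s ≤ suc (length s)
  qDivisiblePoints-bound x []      = divisible-once x
  qDivisiblePoints-bound x (g ∷ s) = begin
    ∑[ k < q ] (𝟙 (q ∣? (k * P + x)) + qDivisiblePoints (k * P + x + g) s)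
      ≡⟨ ∑-distrib-+ q _ _ ⟩
    ∑[ k < q ] 𝟙 (q ∣? (k * P + x)) + ∑[ k < q ] qDivisiblePoints (k * P + x + g) s
      ≡⟨ cong (∑[ k < q ] 𝟙 (q ∣? (k * P + x)) +_) (∑-cong q (λ k → cong (λ y → qDivisiblePoints y s) (+-assoc (k * P) x g))) ⟩
    ∑[ k < q ] 𝟙 (q ∣? (k * P + x)) + ∑[ k < q ] qDivisiblePoints (k * P + (x + g)) s
      ≤⟨ +-mono-≤ (divisible-once x) (qDivisiblePoints-bound (x + g) s) ⟩
    suc (suc (length s)) ∎
    where open ≤-Reasoning

  lifted-occurrences : ∀ {x} s → GP.OccursAt x s → q ∸ suc (length s) ≤ ∑[ k < q ] 𝟙 (GQ.occursAt? (k * P + x) s)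
  lifted-occurrences {x} s occ = m≤n+o⇒m∸n≤o q (suc (length s)) (begin
    q                                                           ≡⟨ trans (∑-const q 1) (*-identityʳ q) ⟨
    ∑[ k < q ] 1                                                ≤⟨ ∑-mono-≤ q (λ k → occursAt-or-divisible s (GP.occursAt-+* k s occ)) ⟩
    ∑[ k < q ] (lifted k + qDivisiblePoints (k * P + x) s)     ≡⟨ ∑-distrib-+ q lifted _ ⟩
    ∑< q lifted + ∑[ k < q ] qDivisiblePoints (k * P + x) s    ≤⟨ +-monoʳ-≤ (∑< q lifted) (qDivisiblePoints-bound x s) ⟩
    ∑< q lifted + suc (length s)                                ≡⟨ +-comm (∑< q lifted) (suc (length s)) ⟩
    suc (length s) + ∑< q lifted                                ∎)
    where
    open ≤-Reasoning
    lifted : ℕ → ℕ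
    lifted k = 𝟙 (GQ.occursAt? (k * P + x) s)

  occurrences-grow : ∀ s → (q ∸ suc (length s)) * ∑[ a < P ] 𝟙 (GP.occursAt? (suc a) s)
                           ≤ ∑[ b < Q ] 𝟙 (GQ.occursAt? (suc b) s)
  occurrences-grow s = begin
    K * ∑[ a < P ] 𝟙 (GP.occursAt? (suc a) s)                  ≡⟨ *-distribˡ-∑ K P _ ⟩
    ∑[ a < P ] (K * 𝟙 (GP.occursAt? (suc a) s))                ≤⟨ ∑-mono-≤ P (λ a → lifts-of (suc a)) ⟩
    ∑[ a < P ] ∑[ k < q ] 𝟙 (GQ.occursAt? (k * P + suc a) s)   ≡⟨ ∑-cong P (λ a → ∑-cong q (λ k →
                                                                    cong (λ b → 𝟙 (GQ.occursAt? b s)) (+-suc (k * P) a))) ⟩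
    ∑[ a < P ] ∑[ k < q ] 𝟙 (GQ.occursAt? (suc (k * P + a)) s) ≡⟨ ∑-comm P q _ ⟩
    ∑[ k < q ] ∑[ a < P ] 𝟙 (GQ.occursAt? (suc (k * P + a)) s) ≡⟨ ∑-* q P (λ b → 𝟙 (GQ.occursAt? (suc b) s)) ⟨
    ∑[ b < q * P ] 𝟙 (GQ.occursAt? (suc b) s)                  ≡⟨ cong (λ n → ∑[ b < n ] 𝟙 (GQ.occursAt? (suc b) s)) Q≡qP ⟨
    ∑[ b < Q ] 𝟙 (GQ.occursAt? (suc b) s)                      ∎
    where
    open ≤-Reasoning
    K = q ∸ suc (length s)
    lifts-of : ∀ x → K * 𝟙 (GP.occursAt? x s) ≤ ∑[ k < q ] 𝟙 (GQ.occursAt? (k * P + x) s)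
    lifts-of x with GP.occursAt? x s
    ... | yes occ = ≤-trans (≤-reflexive (*-identityʳ K)) (lifted-occurrences s occ)
    ... | no _    = ≤-trans (≤-reflexive (*-zeroʳ K)) z≤n

m<n∸2⇒1+m<n : ∀ {m n} → m < n ∸ 2 → suc m < n
m<n∸2⇒1+m<n {n = suc (suc n)} m<n = s≤s (s≤s (<⇒≤ m<n))

lemma3p1 : (p q : ℕ) → NextPrime p q → (s : List ℕ) →
    1 ≤ nsJ s p →
    length s < q ∸ 2 →
    sum s < 2 * q →
    (nsJ s p ≤ nsJ s q) × (wsJ s p Q.≤ wsJ s q)
lemma3p1 p q np@(_ , prime-q , p<q , _) s _ J<q∸2 _ = n-ineq , w-ineq
  where
  J = length s
  K = q ∸ suc J

  1+J<q : suc J < q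
  1+J<q = m<n∸2⇒1+m<n J<q∸2

  open Lift (primorial p) q (primorial q) {{primorial-nonZero p}} {{primorial-nonZero q}}
            prime-q (prime∤primorial prime-q p<q) (primorial-nextPrime np)

  K*n≤n′ : K * nsJ s p ≤ nsJ s q
  K*n≤n′ = subst₂ (λ m n → K * m ≤ n) (sym (GP.windows≡occurrences {{primorial-nonZero p}} s))
                  (sym (GQ.windows≡occurrences {{primorial-nonZero q}} s)) (occurrences-grow s)

  n-ineq : nsJ s p ≤ nsJ s q
  n-ineq = ≤-trans (m≤n*m (nsJ s p) K {{>-nonZero (m<n⇒0<n∸m 1+J<q)}}) K*n≤n′

  w-ineq : wsJ s p Q.≤ wsJ s q
  w-ineq = /-mono-≤ (nsJ s p) (relDen J p) (nsJ s q) (relDen J q) {{relDen-nonZero {J} {p}}} {{relDen-nonZero {J} {q}}} (begin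
    nsJ s p * relDen J q         ≡⟨ cong (nsJ s p *_) (relDen-nextPrime J np 1+J<q) ⟩
    nsJ s p * (K * relDen J p)   ≡⟨ *-assoc (nsJ s p) K (relDen J p) ⟨
    nsJ s p * K * relDen J p     ≡⟨ cong (_* relDen J p) (*-comm (nsJ s p) K) ⟩
    K * nsJ s p * relDen J p     ≤⟨ *-monoˡ-≤ (relDen J p) K*n≤n′ ⟩
    nsJ s q * relDen J p         ∎)
    where open ≤-Reasoning
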